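{- Let $p > 2$ be a prime and let $1 \leq m < p$ be an integer. Suppose $|\mathcal{L}_{\lambda}(p)| = p-1$. Then: (a) if $m$ is odd then $\lambda(p+m) = \lambda(m)$; (b) if $m \equiv p \pmod{3}$ then $\lambda(2p+m) = \lambda(m)$; (c) if $m \equiv 2p \pmod{3}$ then $\lambda(2p-m) = \lambda(p-1)\lambda(m)$.
   Context: $\lambda$ is the Liouville function, $\lambda(n)=(-1)^{\Omega(n)}$ with $\Omega(n)$ the number of prime factors of $n$ counted with multiplicity. For an integer $N \geq 1$, $\mathcal{L}_{\lambda}(N) := \sum_{1 \leq n < N} \lambda(n)\lambda(N-n)$. -}

module Defs where

open import Data.Nat using (ℕ; zero; suc; _∸_; _<_)
open import Data.Nat.Primality.Factorisation using (factorise; factors)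
open import Data.List using (length; upTo; map; drop; foldr)
open import Data.Integer using (ℤ; +_; -_; _*_; _+_; 1ℤ; 0ℤ)

Ω : (n : ℕ) → .{{_ : Data.Nat.NonZero n}} → ℕ
Ω n = length (factors (factorise n))

negOnePow : ℕ → ℤ
negOnePow zero = 1ℤ
negOnePow (suc k) = - negOnePow k

-- Liouville function λ(n) = (-1)^Ω(n) for n ≥ 1; the value at 0 is a
-- junk value 0 that is never used in the statement.
liouville : ℕ → ℤ
liouville zero = 0ℤ
liouville (suc k) = negOnePow (Ω (suc k))

-- 𝓛_λ(N) = Σ_{1 ≤ n < N} λ(n) λ(N - n)
-- upTo N = [0, 1, ..., N-1]; drop 1 gives [1, ..., N-1].
Lλ : ℕ → ℤ
Lλ N = foldr _+_ 0ℤ (map (λ n → liouville n * liouville (N ∸ n)) (drop 1 (upTo N)))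

{-# OPTIONS --safe #-}
-- Each of the p − 1 terms of 𝓛_λ(p) is ±1, so |𝓛_λ(p)| = p − 1 forces all of them to equal the
-- term at n = 1: λ(x)λ(y) = λ(p − 1) =: c whenever x + y = p.  As λ(qz) = −λ(z) for a prime q,
-- the pairs (qx, qy) have the same product c.  If p = m + qk, comparing the pair (qk, m) with
-- q·(k, m + (q − 1)k) gives λ((q − 1)p + m) = λ(m): this is (a) for q = 2 and (b) for q = 3.
-- For (c), if m = 2a use the pair (2a, 2(p − a)); if m is odd write 2p = m + 3k, so that
-- 2p − m = 3k and p + m = 3(p − k), and use (a) with the pair (3(p − k), 3k).
module Submission where

open import Defs
open import Data.Nat using (ℕ; _≤_; _<_; _+_; _*_; _∸_; _%_)
open import Data.Nat.Primality using (Prime)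
open import Data.Integer using (∣_∣)
import Data.Integer as ℤ
open import Data.Product using (_×_)
open import Relation.Binary.PropositionalEquality using (_≡_)
open import Relation.Nullary using (¬_)
open import Data.Nat.Divisibility using (_∣_)

open import Data.Empty using (⊥-elim)
open import Data.Integer using (ℤ; +_; -_; 1ℤ; -1ℤ; 0ℤ; -≤+)
import Data.Integer.Properties as ℤ
open import Data.List using (List; []; _∷_; length; map; foldr; applyUpTo)
open import Data.List.Properties using (length-map; length-applyUpTo)
open import Data.List.Relation.Binary.Permutation.Propositional.Properties using (↭-length)
open import Data.List.Relation.Unary.All as All using (All; []; _∷_)
open import Data.List.Relation.Unary.All.Properties using (map⁺; map⁻; applyUpTo⁺₁; applyUpTo⁻)
open import Data.Nat using (zero; suc; z≤n; s≤s; z<s; _/_; NonZero)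
import Data.Nat.Properties as ℕ
open import Data.Nat.DivMod using (m≡m%n+[m/n]*n; m%n<n; /-monoˡ-≤)
open import Data.Nat.Divisibility using (divides; _∣?_; m%n≡0⇒n∣m)
open import Data.Nat.Primality using (prime[2]; prime?; ¬prime[0]; prime⇒irreducible; prime⇒nonZero)
open import Data.Nat.Primality.Factorisation using (PrimeFactorisation; factorise; factors; factorisationUnique)
open import Data.Nat.Tactic.RingSolver using (solve-∀)
open import Data.Product using (_,_; proj₁; proj₂; ∃-syntax)
open import Data.Sum using (inj₁; inj₂)
open import Relation.Binary.PropositionalEquality using (refl; sym; trans; cong; cong₂; subst; module ≡-Reasoning)
open import Relation.Nullary using (yes; no)
open import Relation.Nullary.Decidable using (from-yes)

data IsSign : ℤ → Set where
  +one : IsSign 1ℤ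
  -one : IsSign -1ℤ

isSign-neg : ∀ {x} → IsSign x → IsSign (- x)
isSign-neg +one = -one
isSign-neg -one = +one

isSign-* : ∀ {x y} → IsSign x → IsSign y → IsSign (x ℤ.* y)
isSign-* +one +one = +one
isSign-* +one -one = -one
isSign-* -one +one = -one
isSign-* -one -one = +one

isSign-≤1 : ∀ {x} → IsSign x → x ℤ.≤ 1ℤ
isSign-≤1 +one = ℤ.≤-refl
isSign-≤1 -one = -≤+

isSign-square : ∀ {s} → IsSign s → s ℤ.* s ≡ 1ℤ
isSign-square +one = refl
isSign-square -one = refl

isSign-cancelˡ : ∀ {s} → IsSign s → ∀ x y → s ℤ.* x ≡ s ℤ.* y → x ≡ y
isSign-cancelˡ +one x y = ℤ.*-cancelˡ-≡ 1ℤ x y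
isSign-cancelˡ -one x y = ℤ.*-cancelˡ-≡ -1ℤ x y

isSign-solveˡ : ∀ {s y c} → IsSign s → s ℤ.* y ≡ c → y ≡ c ℤ.* s
isSign-solveˡ {s} {y} {c} s± sy≡c = begin
  y                 ≡⟨ ℤ.*-identityˡ y ⟨
  1ℤ ℤ.* y          ≡⟨ cong (ℤ._* y) (isSign-square s±) ⟨
  s ℤ.* s ℤ.* y     ≡⟨ ℤ.*-assoc s s y ⟩
  s ℤ.* (s ℤ.* y)   ≡⟨ cong (s ℤ.*_) sy≡c ⟩
  s ℤ.* c           ≡⟨ ℤ.*-comm s c ⟩
  c ℤ.* s           ∎
  where open ≡-Reasoning

sum : List ℤ → ℤ
sum = foldr ℤ._+_ 0ℤ

sum-map-neg : ∀ xs → sum (map -_ xs) ≡ - sum xs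
sum-map-neg []       = refl
sum-map-neg (x ∷ xs) =
  trans (cong (ℤ._+_ (- x)) (sum-map-neg xs)) (sym (ℤ.neg-distrib-+ x (sum xs)))

sum-≤-length : ∀ {xs} → All IsSign xs → sum xs ℤ.≤ + length xs
sum-≤-length []       = ℤ.≤-refl
sum-≤-length (s ∷ ss) = ℤ.+-mono-≤ (isSign-≤1 s) (sum-≤-length ss)

sum≡length⇒all≡1 : ∀ {xs} → All IsSign xs → sum xs ≡ + length xs → All (_≡ 1ℤ) xs
sum≡length⇒all≡1 []                   _  = []
sum≡length⇒all≡1 (+one ∷ ss)          eq =
  refl ∷ sum≡length⇒all≡1 ss (trans (sym (ℤ.pred-suc _)) (cong ℤ.pred eq))
sum≡length⇒all≡1 {_ ∷ xs} (-one ∷ ss) eq =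
  ⊥-elim (ℕ.1+n≰n (ℕ.≤-trans (ℕ.n≤1+n _) (ℤ.drop‿+≤+ too-big)))
  where
  too-big : + suc (suc (length xs)) ℤ.≤ + length xs
  too-big = subst (ℤ._≤ + length xs) (trans (sym (ℤ.suc-pred _)) (cong ℤ.suc eq)) (sum-≤-length ss)

∣sum∣≡length⇒constant : ∀ {xs} → All IsSign xs → ∣ sum xs ∣ ≡ length xs → ∃[ s ] All (_≡ s) xs
∣sum∣≡length⇒constant {xs} ss eq with ℤ.+∣i∣≡i⊎+∣i∣≡-i (sum xs)
... | inj₁ +∣S∣≡S  = 1ℤ , sum≡length⇒all≡1 ss (trans (sym +∣S∣≡S) (cong +_ eq))
... | inj₂ +∣S∣≡-S =
  -1ℤ , All.map (λ -x≡1 → trans (sym (ℤ.neg-involutive _)) (cong -_ -x≡1)) (map⁻ all≡1)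
  where
  all≡1 : All (_≡ 1ℤ) (map -_ xs)
  all≡1 = sum≡length⇒all≡1 (map⁺ (All.map isSign-neg ss)) (begin
    sum (map -_ xs)       ≡⟨ sum-map-neg xs ⟩
    - sum xs              ≡⟨ +∣S∣≡-S ⟨
    + ∣ sum xs ∣          ≡⟨ cong +_ (trans eq (sym (length-map -_ xs))) ⟩
    + length (map -_ xs)  ∎)
    where open ≡-Reasoning

negOnePow-isSign : ∀ k → IsSign (negOnePow k)
negOnePow-isSign zero    = +one
negOnePow-isSign (suc k) = isSign-neg (negOnePow-isSign k)

liouville-isSign : ∀ {n} → 0 < n → IsSign (liouville n)
liouville-isSign {suc n} _ = negOnePow-isSign (Ω (suc n))

liouville-*-prime : ∀ {q n} → Prime q → 0 < n → liouville (q * n) ≡ - liouville n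
liouville-*-prime {zero}  q-prime _ = ⊥-elim (¬prime[0] q-prime)
liouville-*-prime {suc q} {suc n} q-prime _ =
  cong negOnePow (↭-length (factorisationUnique (factorise _) qn-factorisation))
  where
  n-factorisation = factorise (suc n)
  qn-factorisation : PrimeFactorisation (suc q * suc n)
  qn-factorisation = record
    { factors         = suc q ∷ factors n-factorisation
    ; isFactorisation = cong (suc q *_) (PrimeFactorisation.isFactorisation n-factorisation)
    ; factorsPrime    = q-prime ∷ PrimeFactorisation.factorsPrime n-factorisation
    }

ConstantOnAntidiagonal : ℕ → ℤ → Set
ConstantOnAntidiagonal P c =
  ∀ {x y} → 0 < x → 0 < y → x + y ≡ P → liouville x ℤ.* liouville y ≡ c

∣Lλ∣≡pred⇒terms-constant : ∀ {q} → ∣ Lλ (suc q) ∣ ≡ q →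
  ∀ {i} → i < q → liouville (suc i) ℤ.* liouville (q ∸ i) ≡ liouville q
∣Lλ∣≡pred⇒terms-constant {q} ∣Lλ∣≡q {i} i<q = begin
  term (suc i)  ≡⟨ term≡s i<q ⟩
  proj₁ const   ≡⟨ term≡s (ℕ.≤-<-trans z≤n i<q) ⟨
  term 1        ≡⟨ ℤ.*-identityˡ (liouville q) ⟩
  liouville q   ∎
  where
  open ≡-Reasoning
  term : ℕ → ℤ
  term n = liouville n ℤ.* liouville (suc q ∸ n)
  terms-isSign : All IsSign (map term (applyUpTo suc q))
  terms-isSign = map⁺ (applyUpTo⁺₁ suc q λ {i} i<q →
    isSign-* (liouville-isSign {suc i} z<s) (liouville-isSign (ℕ.m<n⇒0<n∸m i<q)))
  terms-length : length (map term (applyUpTo suc q)) ≡ q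
  terms-length = trans (length-map term (applyUpTo suc q)) (length-applyUpTo suc q)
  const : ∃[ s ] All (_≡ s) (map term (applyUpTo suc q))
  const = ∣sum∣≡length⇒constant terms-isSign (trans ∣Lλ∣≡q (sym terms-length))
  term≡s : ∀ {i} → i < q → term (suc i) ≡ proj₁ const
  term≡s = applyUpTo⁻ suc q (map⁻ (proj₂ const))

∣Lλ∣≡pred⇒constantOnAntidiagonal : ∀ P → ∣ Lλ P ∣ ≡ P ∸ 1 →
  ConstantOnAntidiagonal P (liouville (P ∸ 1))
∣Lλ∣≡pred⇒constantOnAntidiagonal zero    _     {suc _} _ _ ()
∣Lλ∣≡pred⇒constantOnAntidiagonal (suc q) ∣Lλ∣≡q {suc i} {y} _ 0<y refl =
  subst (λ z → liouville (suc i) ℤ.* liouville z ≡ liouville q) (ℕ.m+n∸m≡n i y)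
    (∣Lλ∣≡pred⇒terms-constant ∣Lλ∣≡q (ℕ.m<m+n i 0<y))

constantOnAntidiagonal-*-prime : ∀ {P c q x y} → ConstantOnAntidiagonal P c → Prime q →
  0 < x → 0 < y → x + y ≡ P → liouville (q * x) ℤ.* liouville (q * y) ≡ c
constantOnAntidiagonal-*-prime {c = c} {q} {x} {y} const q-prime 0<x 0<y x+y≡P = begin
  liouville (q * x) ℤ.* liouville (q * y)  ≡⟨ cong₂ ℤ._*_ (liouville-*-prime q-prime 0<x)
                                                          (liouville-*-prime q-prime 0<y) ⟩
  (- λx) ℤ.* (- λy)                        ≡⟨ ℤ.neg-distribˡ-* λx (- λy) ⟨
  - (λx ℤ.* (- λy))                        ≡⟨ cong -_ (ℤ.neg-distribʳ-* λx λy) ⟨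
  - (- (λx ℤ.* λy))                        ≡⟨ ℤ.neg-involutive (λx ℤ.* λy) ⟩
  λx ℤ.* λy                                ≡⟨ const 0<x 0<y x+y≡P ⟩
  c                                        ∎
  where
  open ≡-Reasoning
  λx = liouville x
  λy = liouville y

%-≡⇒≡+* : ∀ {m o} n .{{_ : NonZero n}} → m % n ≡ o % n → m ≤ o → ∃[ d ] o ≡ m + n * d
%-≡⇒≡+* {m} {o} n m%n≡o%n m≤o = d , (begin
  o                              ≡⟨ m≡m%n+[m/n]*n o n ⟩
  o % n + o / n * n              ≡⟨ cong₂ _+_ m%n≡o%n (cong (_* n) (ℕ.m+[n∸m]≡n (/-monoˡ-≤ n m≤o))) ⟨
  m % n + (m / n + d) * n        ≡⟨ regroup (m % n) (m / n) d n ⟩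
  (m % n + m / n * n) + n * d    ≡⟨ cong (_+ n * d) (m≡m%n+[m/n]*n m n) ⟨
  m + n * d                      ∎)
  where
  open ≡-Reasoning
  d = o / n ∸ m / n
  regroup : ∀ r a d n → r + (a + d) * n ≡ (r + a * n) + n * d
  regroup = solve-∀

%-≡∧<⇒≡+*suc : ∀ {m o} n .{{_ : NonZero n}} → m % n ≡ o % n → m < o → ∃[ k ] o ≡ m + n * suc k
%-≡∧<⇒≡+*suc {m} n m%n≡o%n m<o with %-≡⇒≡+* n m%n≡o%n (ℕ.<⇒≤ m<o)
... | zero  , o≡m+n*0 =
  ⊥-elim (ℕ.<-irrefl (sym (trans o≡m+n*0 (trans (cong (_+_ m) (ℕ.*-zeroʳ n)) (ℕ.+-identityʳ m)))) m<o)
... | suc k , o≡m+n*k = k , o≡m+n*k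

¬2∣⇒%2≡1 : ∀ n → ¬ 2 ∣ n → n % 2 ≡ 1
¬2∣⇒%2≡1 n 2∤n with n % 2 | m%n<n n 2 | m%n≡0⇒n∣m n 2
... | 0           | _                | 2∣n = ⊥-elim (2∤n (2∣n refl))
... | 1           | _                | _   = refl
... | suc (suc _) | s≤s (s≤s ())     | _

prime>2⇒¬2∣ : ∀ {p} → Prime p → 2 < p → ¬ 2 ∣ p
prime>2⇒¬2∣ p-prime 2<p 2∣p with prime⇒irreducible p-prime 2∣p
... | inj₂ refl = ℕ.<-irrefl refl 2<p

prime[3] : Prime 3
prime[3] = from-yes (prime? 3)

liouville-shift : ∀ {q P c m} .{{_ : NonZero q}} → Prime q → ConstantOnAntidiagonal P c →
  0 < m → m < P → m % q ≡ P % q → liouville ((q ∸ 1) * P + m) ≡ liouville m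
liouville-shift {zero} q-prime = ⊥-elim (¬prime[0] q-prime)
liouville-shift {suc j} {c = c} {m} q-prime const 0<m m<P m≡P with %-≡∧<⇒≡+*suc (suc j) m≡P m<P
... | k , refl = begin
  liouville (j * (m + q * suc k) + m)  ≡⟨ cong liouville (regroup j k m) ⟩
  liouville (q * n)                    ≡⟨ isSign-cancelˡ (liouville-isSign {q * suc k} z<s) _ _
                                                          (trans scaled (sym direct)) ⟩
  liouville m                          ∎
  where
  open ≡-Reasoning
  q = suc j
  n = m + j * suc k
  scaled : liouville (q * suc k) ℤ.* liouville (q * n) ≡ c
  scaled = constantOnAntidiagonal-*-prime {x = suc k} const q-prime
             z<s (ℕ.<-≤-trans 0<m (ℕ.m≤m+n m _)) (split j k m)
    where
    split : ∀ j k m → (1 + k) + (m + j * (1 + k)) ≡ m + (1 + j) * (1 + k)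
    split = solve-∀
  direct : liouville (q * suc k) ℤ.* liouville m ≡ c
  direct = const {q * suc k} z<s 0<m (ℕ.+-comm (q * suc k) m)
  regroup : ∀ j k m → j * (m + (1 + j) * (1 + k)) + m ≡ (1 + j) * (m + j * (1 + k))
  regroup = solve-∀

liouville-shift-odd : ∀ {P c m} → ConstantOnAntidiagonal P c → ¬ 2 ∣ P → ¬ 2 ∣ m →
  0 < m → m < P → liouville (P + m) ≡ liouville m
liouville-shift-odd {P} {m = m} const P-odd m-odd 0<m m<P =
  subst (λ n → liouville (n + m) ≡ liouville m) (ℕ.*-identityˡ P)
    (liouville-shift prime[2] const 0<m m<P (trans (¬2∣⇒%2≡1 m m-odd) (sym (¬2∣⇒%2≡1 P P-odd))))

liouville-reflect-multiple : ∀ {P c q m} → ConstantOnAntidiagonal P c → Prime q → q ∣ m →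
  0 < m → m < P → liouville m ℤ.* liouville (q * P ∸ m) ≡ c
liouville-reflect-multiple {P} {c} {q} const q-prime (divides (suc a) refl) 0<m m<P =
  subst (λ x → liouville x ℤ.* liouville (q * P ∸ x) ≡ c) (ℕ.*-comm q (suc a))
    (subst (λ y → liouville (q * suc a) ℤ.* liouville y ≡ c) (ℕ.*-distribˡ-∸ q P (suc a))
      (constantOnAntidiagonal-*-prime const q-prime z<s (ℕ.m<n⇒0<n∸m a<P) (ℕ.m+[n∸m]≡n (ℕ.<⇒≤ a<P))))
  where
  instance _ = prime⇒nonZero q-prime
  a<P : suc a < P
  a<P = ℕ.≤-<-trans (ℕ.m≤m*n (suc a) q) m<P

liouville-reflect-odd : ∀ {P c m} → ConstantOnAntidiagonal P c → ¬ 2 ∣ P → ¬ 2 ∣ m →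
  0 < m → m < P → m % 3 ≡ (2 * P) % 3 → liouville m ℤ.* liouville (2 * P ∸ m) ≡ c
liouville-reflect-odd {P} {c} {m} const P-odd m-odd 0<m m<P m≡2P
  with %-≡∧<⇒≡+*suc 3 m≡2P (ℕ.<-≤-trans m<P (ℕ.m≤m+n P _))
... | k-1 , 2P≡m+3k = begin
  liouville m ℤ.* liouville (2 * P ∸ m)  ≡⟨ cong₂ ℤ._*_ λm≡λ3r (cong liouville 2P∸m≡3k) ⟩
  liouville (3 * r) ℤ.* liouville (3 * k) ≡⟨ constantOnAntidiagonal-*-prime const prime[3]
                                                (ℕ.m<n⇒0<n∸m k<P) z<s r+k≡P ⟩
  c                                       ∎
  where
  open ≡-Reasoning
  k = suc k-1
  k<P : k < P
  k<P = ℕ.*-cancelˡ-< 3 k P (ℕ.≤-<-trans (ℕ.m≤n+m (3 * k) m)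
    (subst (_< 3 * P) 2P≡m+3k (ℕ.m<n+m (2 * P) (ℕ.<-trans 0<m m<P))))
  r = P ∸ k
  r+k≡P : r + k ≡ P
  r+k≡P = ℕ.m∸n+n≡m (ℕ.<⇒≤ k<P)
  P+m≡3r : P + m ≡ 3 * r
  P+m≡3r = ℕ.+-cancelʳ-≡ (3 * k) (P + m) (3 * r) (begin
    P + m + 3 * k    ≡⟨ ℕ.+-assoc P m (3 * k) ⟩
    P + (m + 3 * k)  ≡⟨ cong (_+_ P) 2P≡m+3k ⟨
    3 * P            ≡⟨ cong (3 *_) r+k≡P ⟨
    3 * (r + k)      ≡⟨ ℕ.*-distribˡ-+ 3 r k ⟩
    3 * r + 3 * k    ∎)
  λm≡λ3r : liouville m ≡ liouville (3 * r)
  λm≡λ3r = trans (sym (liouville-shift-odd const P-odd m-odd 0<m m<P)) (cong liouville P+m≡3r)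
  2P∸m≡3k : 2 * P ∸ m ≡ 3 * k
  2P∸m≡3k = trans (cong (_∸ m) 2P≡m+3k) (ℕ.m+n∸m≡n m (3 * k))

liouville-reflect : ∀ {P c m} → ConstantOnAntidiagonal P c → ¬ 2 ∣ P →
  0 < m → m < P → m % 3 ≡ (2 * P) % 3 → liouville m ℤ.* liouville (2 * P ∸ m) ≡ c
liouville-reflect {m = m} const P-odd 0<m m<P m≡2P with 2 ∣? m
... | yes m-even = liouville-reflect-multiple const prime[2] m-even 0<m m<P
... | no  m-odd  = liouville-reflect-odd const P-odd m-odd 0<m m<P m≡2P

lemma2p2 : (p m : ℕ) → Prime p → 2 < p → 1 ≤ m → m < p
    → ∣ Lλ p ∣ ≡ p ∸ 1
    → ((¬ (2 ∣ m) → liouville (p + m) ≡ liouville m)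
       × (m % 3 ≡ p % 3 → liouville (2 * p + m) ≡ liouville m)
       × (m % 3 ≡ (2 * p) % 3 → liouville (2 * p ∸ m) ≡ liouville (p ∸ 1) ℤ.* liouville m))
lemma2p2 p m p-prime 2<p 0<m m<p ∣Lλp∣≡p-1 =
    (λ m-odd → liouville-shift-odd const p-odd m-odd 0<m m<p)
  , (λ m≡p → liouville-shift prime[3] const 0<m m<p m≡p)
  , (λ m≡2p → isSign-solveˡ (liouville-isSign 0<m) (liouville-reflect const p-odd 0<m m<p m≡2p))
  where
  const : ConstantOnAntidiagonal p (liouville (p ∸ 1))
  const = ∣Lλ∣≡pred⇒constantOnAntidiagonal p ∣Lλp∣≡p-1
  p-odd : ¬ 2 ∣ p
  p-odd = prime>2⇒¬2∣ p-prime 2<p
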